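{- Let $r\geqslant 2$ and let $(S_1,S_2)$ be an Euler pair of order $r$. Then for every $n\geqslant 0$, $$q_r(S_1;n)\equiv \overline p_r(S_1;n)\pmod 2.$$
   Context: For a set $S$ of positive integers, $p(S;n)$ is the number of partitions of $n$ with all parts in $S$, and for $k\geqslant 2$, $q_k(S;n)$ is the number of partitions of $n$ with parts in $S$ in which each part occurs at most $k-1$ times. A pair $(S_1,S_2)$ of subsets of the positive integers is an Euler pair of order $r$ if $q_r(S_1;n)=p(S_2;n)$ for all $n\geqslant 0$. An overpartition of $n$ is a partition of $n$ in which the first occurrence of a part may be overlined. For an Euler pair $(S_1,S_2)$ of order $r$, $\overline p_r(S_1;n)$ denotes the number of overpartitions of $n$ with all parts in $S_1$ in which only parts belonging to $S_1\setminus S_2$ may be overlined. -}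

module Defs where

open import Data.Nat using (ℕ; zero; suc; _+_; _*_; _∸_; _≤ᵇ_; _<ᵇ_; _≡ᵇ_; _%_)
open import Data.Bool using (Bool; true; false; if_then_else_; _∧_; not)
open import Relation.Binary.PropositionalEquality using (_≡_; refl)

-- A set S of positive integers is represented by its (decidable)
-- characteristic function S : ℕ → Bool; only values at 1,2,3,... are ever used.
Subset : Set
Subset = ℕ → Bool

-- A partition of n with all parts ≤ k is the same as a multiplicity
-- assignment (m_1,...,m_k) with Σ i·m_i = n.  A "weight" w i j gives the
-- number of admissible ways for part i to occur exactly j times
-- (0 = forbidden, 1 = allowed, 2 = allowed with/without overlining the
-- first occurrence).  count w k n = Σ over multiplicity assignments
-- (m_1..m_k) with Σ i·m_i = n of Π_i w i m_i.

sumUpTo : ℕ → (ℕ → ℕ) → ℕ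
sumUpTo zero    f = f 0
sumUpTo (suc J) f = sumUpTo J f + f (suc J)

count : (ℕ → ℕ → ℕ) → ℕ → ℕ → ℕ
count w zero    n = if n ≡ᵇ 0 then 1 else 0
count w (suc k) n =
  sumUpTo n (λ j → if j * suc k ≤ᵇ n
                      then w (suc k) j * count w k (n ∸ j * suc k)
                      else 0)

pW : Subset → ℕ → ℕ → ℕ
pW S i j = if S i then 1 else (if j ≡ᵇ 0 then 1 else 0)

qW : ℕ → Subset → ℕ → ℕ → ℕ
qW k S i j = if S i ∧ (j <ᵇ k) then 1 else (if j ≡ᵇ 0 then 1 else 0)

-- weight for overpartitions with parts in S₁ where only parts in S₁ \ S₂
-- may be overlined (the first occurrence of a part occurring j ≥ 1 times
-- may or may not be overlined: 2 choices).
pbarW : Subset → Subset → ℕ → ℕ → ℕ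
pbarW S₁ S₂ i j =
  if S₁ i
    then (if j ≡ᵇ 0 then 1 else (if S₂ i then 1 else 2))
    else (if j ≡ᵇ 0 then 1 else 0)

-- p(S;n): partitions of n with all parts in S (parts are ≤ n)
p : Subset → ℕ → ℕ
p S n = count (pW S) n n

q : ℕ → Subset → ℕ → ℕ
q k S n = count (qW k S) n n

EulerPair : ℕ → Subset → Subset → Set
EulerPair r S₁ S₂ = ∀ n → q r S₁ n ≡ p S₂ n

-- \overline{p}_r(S₁;n) for an Euler pair (S₁,S₂) of order r
-- (the value does not depend on r beyond the Euler-pair hypothesis)
pbar : ℕ → Subset → Subset → ℕ → ℕ
pbar r S₁ S₂ n = count (pbarW S₁ S₂) n n

private
  allS oddS : Subset
  allS _ = true
  oddS n = (n % 2) ≡ᵇ 1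

  _ : p allS 5 ≡ 7
  _ = refl
  _ : q 2 allS 5 ≡ 3
  _ = refl
  _ : p oddS 5 ≡ 3
  _ = refl
  _ : count (pbarW allS (λ _ → false)) 4 4 ≡ 14
  _ = refl

-- The Euler-pair identity reads ∏_{i∈S₁} (1 - x^(ri))/(1 - x^i) = ∏_{i∈S₂} 1/(1 - x^i).
-- Order the factors on the left by the exponent of x they involve and compare both
-- sides one coefficient at a time: at x^m the left side can gain the factors 1/(1 - x^m)
-- and 1 - x^m, the right side only 1/(1 - x^m), and the coefficient of x^m forces the
-- right side to use 1/(1 - x^m) only when the left side does.  Hence S₂ ⊆ S₁.
-- Modulo 2, overlining a part of S₁ \ S₂ doubles its weight and so kills it, while the
-- parts of S₁ ∩ S₂ = S₂ keep weight 1; so p̄_r(S₁; n) ≡ p(S₂; n) = q_r(S₁; n).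
module Submission where

open import Defs
open import Data.Bool using (Bool; true; false; if_then_else_; _∧_)
open import Data.Integer using (ℤ; +_; 0ℤ; 1ℤ; -1ℤ)
  renaming (_+_ to _+ᶻ_; _*_ to _*ᶻ_; _-_ to _-ᶻ_; -_ to negᶻ)
import Data.Integer.Properties as ℤₚ
open import Algebra.Properties.AbelianGroup ℤₚ.+-0-abelianGroup
  using (∙-cancelˡ; //-rightDividesʳ)
open import Algebra.Properties.CommutativeSemigroup ℤₚ.+-commutativeSemigroup
  using (interchange)
open import Data.Integer.Tactic.RingSolver using (solve-∀)
import Data.Nat.Tactic.RingSolver as ℕ-Solver
open import Data.Nat
  using (ℕ; zero; suc; _+_; _*_; _∸_; _≤_; _<_; _≤′_; ≤′-refl; ≤′-step; s≤s; z≤n;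
         _≤ᵇ_; _<ᵇ_; _≡ᵇ_; _%_; _/_; _≤?_; NonZero)
open import Data.Nat.Properties
open import Data.Nat.DivMod
  using (m≡m%n+[m/n]*n; m%n<n; m/n≤m; [m+kn]%n≡m%n; m<n⇒m%n≡m; m*n%n≡0; m*n/n≡m;
         %-distribˡ-+; %-distribˡ-*)
open import Data.Product using (_×_; _,_; proj₁; proj₂)
open import Function using (_∘_; id)
open import Relation.Nullary using (yes; no; contradiction)
open import Relation.Nullary.Reflects using (ofʸ)
open import Relation.Binary.PropositionalEquality
open ≡-Reasoning

Series : Set
Series = ℕ → ℤ

sumTo : ℕ → (ℕ → ℤ) → ℤ
sumTo zero    f = f 0
sumTo (suc N) f = sumTo N f +ᶻ f (suc N)

sumTo-cong : ∀ N {f g : ℕ → ℤ} → f ≗ g → sumTo N f ≡ sumTo N g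
sumTo-cong zero    f≗g = f≗g 0
sumTo-cong (suc N) f≗g = cong₂ _+ᶻ_ (sumTo-cong N f≗g) (f≗g (suc N))

sumTo-zero : ∀ N {f : ℕ → ℤ} → (∀ j → f j ≡ 0ℤ) → sumTo N f ≡ 0ℤ
sumTo-zero zero    f≡0 = f≡0 0
sumTo-zero (suc N) f≡0 = cong₂ _+ᶻ_ (sumTo-zero N f≡0) (f≡0 (suc N))

sumTo-tail : ∀ {N M} {f : ℕ → ℤ} → N ≤ M → (∀ j → N < j → f j ≡ 0ℤ) →
  sumTo M f ≡ sumTo N f
sumTo-tail {N} {f = f} N≤M vanish = go (≤⇒≤′ N≤M)
  where
  go : ∀ {M} → N ≤′ M → sumTo M f ≡ sumTo N f
  go ≤′-refl        = refl
  go (≤′-step N≤′M) =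
    trans (cong₂ _+ᶻ_ (go N≤′M) (vanish _ (s≤s (≤′⇒≤ N≤′M)))) (ℤₚ.+-identityʳ _)

sumTo-suc : ∀ N (f : ℕ → ℤ) → sumTo (suc N) f ≡ f 0 +ᶻ sumTo N (f ∘ suc)
sumTo-suc zero    f = refl
sumTo-suc (suc N) f =
  trans (cong (_+ᶻ f (suc (suc N))) (sumTo-suc N f)) (ℤₚ.+-assoc (f 0) _ _)

sumTo-+ : ∀ N (f g : ℕ → ℤ) → sumTo N (λ j → f j +ᶻ g j) ≡ sumTo N f +ᶻ sumTo N g
sumTo-+ zero    f g = refl
sumTo-+ (suc N) f g =
  trans (cong (_+ᶻ (f (suc N) +ᶻ g (suc N))) (sumTo-+ N f g))
        (interchange (sumTo N f) (sumTo N g) (f (suc N)) (g (suc N)))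

sumTo-swap : ∀ N M (g : ℕ → ℕ → ℤ) →
  sumTo N (λ j → sumTo M (g j)) ≡ sumTo M (λ m → sumTo N (λ j → g j m))
sumTo-swap zero    M g = refl
sumTo-swap (suc N) M g =
  trans (cong (_+ᶻ sumTo M (g (suc N))) (sumTo-swap N M g))
        (sym (sumTo-+ M (λ m → sumTo N (λ j → g j m)) (g (suc N))))

*-sumTo : ∀ c N (f : ℕ → ℤ) → c *ᶻ sumTo N f ≡ sumTo N (λ j → c *ᶻ f j)
*-sumTo c zero    f = refl
*-sumTo c (suc N) f =
  trans (ℤₚ.*-distribˡ-+ c (sumTo N f) (f (suc N)))
        (cong (_+ᶻ c *ᶻ f (suc N)) (*-sumTo c N f))

*-zeroʳ-≡ : ∀ c {x} → x ≡ 0ℤ → c *ᶻ x ≡ 0ℤ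
*-zeroʳ-≡ c refl = ℤₚ.*-zeroʳ c

shift : ℕ → Series → Series
shift d a n = if d ≤ᵇ n then a (n ∸ d) else 0ℤ

shift-≤ : ∀ {d n} (a : Series) → d ≤ n → shift d a n ≡ a (n ∸ d)
shift-≤ {d} {n} a d≤n with d ≤ᵇ n | ≤⇒≤ᵇ d≤n
... | true | _ = refl

shift-> : ∀ {d n} (a : Series) → n < d → shift d a n ≡ 0ℤ
shift-> {d} {n} a n<d with d ≤ᵇ n | ≤ᵇ-reflects-≤ d n
... | false | _       = refl
... | true  | ofʸ d≤n = contradiction d≤n (<⇒≱ n<d)

shift-cong : ∀ d {a b : Series} → a ≗ b → shift d a ≗ shift d b
shift-cong d a≗b n with d ≤ᵇ n
... | true  = a≗b (n ∸ d)
... | false = refl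

shift-map : ∀ d (g : ℤ → ℤ) → g 0ℤ ≡ 0ℤ → (a : Series) →
  shift d (g ∘ a) ≗ g ∘ shift d a
shift-map d g g0≡0 a n with d ≤ᵇ n
... | true  = refl
... | false = sym g0≡0

shift-zipWith : ∀ d (_⊕_ : ℤ → ℤ → ℤ) → 0ℤ ⊕ 0ℤ ≡ 0ℤ → (a b : Series) →
  shift d (λ m → a m ⊕ b m) ≗ λ n → shift d a n ⊕ shift d b n
shift-zipWith d _⊕_ 0⊕0≡0 a b n with d ≤ᵇ n
... | true  = refl
... | false = sym 0⊕0≡0

shift-∸ : ∀ d {e n} (a : Series) → e ≤ n → shift d a (n ∸ e) ≡ shift (e + d) a n
shift-∸ d {e} {n} a e≤n with d ≤? n ∸ e
... | yes d≤n∸e = begin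
  shift d a (n ∸ e) ≡⟨ shift-≤ a d≤n∸e ⟩
  a (n ∸ e ∸ d)     ≡⟨ cong a (∸-+-assoc n e d) ⟩
  a (n ∸ (e + d))   ≡⟨ shift-≤ a (subst (e + d ≤_) (m+[n∸m]≡n e≤n) (+-monoʳ-≤ e d≤n∸e)) ⟨
  shift (e + d) a n ∎
... | no  d≰n∸e = trans (shift-> a (≰⇒> d≰n∸e))
  (sym (shift-> a (subst (_< e + d) (m+[n∸m]≡n e≤n) (+-monoʳ-< e (≰⇒> d≰n∸e)))))

shift-shift : ∀ d e (a : Series) → shift d (shift e a) ≗ shift (e + d) a
shift-shift d e a n with d ≤? n
... | yes d≤n = begin
  shift d (shift e a) n ≡⟨ shift-≤ (shift e a) d≤n ⟩
  shift e a (n ∸ d)     ≡⟨ shift-∸ e a d≤n ⟩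
  shift (d + e) a n     ≡⟨ cong (λ t → shift t a n) (+-comm d e) ⟩
  shift (e + d) a n     ∎
... | no  d≰n = trans (shift-> (shift e a) (≰⇒> d≰n))
  (sym (shift-> a (<-≤-trans (≰⇒> d≰n) (m≤n+m d e))))

shift-index> : ∀ {n j} k (a : Series) → n < j → shift (j * suc k) a n ≡ 0ℤ
shift-index> {j = j} k a n<j = shift-> a (<-≤-trans n<j (m≤m*n j (suc k)))

-- mul c k a is the product of a with Σ_j c j · x^(j·(1+k)); only j ≤ n reach x^n.
mul : (ℕ → ℤ) → ℕ → Series → Series
mul c k a n = sumTo n (λ j → c j *ᶻ shift (j * suc k) a n)

mul-cong : ∀ c k {a b : Series} → a ≗ b → mul c k a ≗ mul c k b
mul-cong c k a≗b n = sumTo-cong n λ j → cong (c j *ᶻ_) (shift-cong (j * suc k) a≗b n)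

mul-congˡ : ∀ {c d : ℕ → ℤ} k (a : Series) → c ≗ d → mul c k a ≗ mul d k a
mul-congˡ k a c≗d n = sumTo-cong n λ j → cong (_*ᶻ shift (j * suc k) a n) (c≗d j)

mul-zeroˡ : ∀ c k (a : Series) → (∀ j → c j ≡ 0ℤ) → ∀ n → mul c k a n ≡ 0ℤ
mul-zeroˡ c k a c≡0 n = sumTo-zero n λ j → cong (_*ᶻ shift (j * suc k) a n) (c≡0 j)

shift-mul : ∀ e c k (a : Series) → shift e (mul c k a) ≗ mul c k (shift e a)
shift-mul e c k a n with e ≤? n
... | yes e≤n = begin
  shift e (mul c k a) n
    ≡⟨ shift-≤ (mul c k a) e≤n ⟩
  sumTo (n ∸ e) (λ j → c j *ᶻ shift (j * suc k) a (n ∸ e))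
    ≡⟨ sumTo-tail (m∸n≤m n e) vanish ⟨
  sumTo n (λ j → c j *ᶻ shift (j * suc k) a (n ∸ e))
    ≡⟨ sumTo-cong n (λ j → cong (c j *ᶻ_) (regroup j)) ⟩
  mul c k (shift e a) n ∎
  where
  vanish : ∀ j → n ∸ e < j → c j *ᶻ shift (j * suc k) a (n ∸ e) ≡ 0ℤ
  vanish j n∸e<j = *-zeroʳ-≡ (c j) (shift-index> k a n∸e<j)
  regroup : ∀ j → shift (j * suc k) a (n ∸ e) ≡ shift (j * suc k) (shift e a) n
  regroup j = trans (shift-∸ (j * suc k) a e≤n) (sym (shift-shift (j * suc k) e a n))
... | no e≰n = trans (shift-> (mul c k a) (≰⇒> e≰n)) (sym (sumTo-zero n vanish))
  where
  vanish : ∀ j → c j *ᶻ shift (j * suc k) (shift e a) n ≡ 0ℤ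
  vanish j = *-zeroʳ-≡ (c j)
    (trans (shift-shift (j * suc k) e a n) (shift-> a (<-≤-trans (≰⇒> e≰n) (m≤m+n e _))))

mul-mul : ∀ c k d l (a : Series) n → mul c k (mul d l a) n ≡
  sumTo n (λ j → sumTo n (λ m → c j *ᶻ d m *ᶻ shift (j * suc k + m * suc l) a n))
mul-mul c k d l a n = sumTo-cong n λ j → begin
  c j *ᶻ shift (j * suc k) (mul d l a) n
    ≡⟨ cong (c j *ᶻ_) (shift-mul (j * suc k) d l a n) ⟩
  c j *ᶻ mul d l (shift (j * suc k) a) n
    ≡⟨ *-sumTo (c j) n _ ⟩
  sumTo n (λ m → c j *ᶻ (d m *ᶻ shift (m * suc l) (shift (j * suc k) a) n))
    ≡⟨ sumTo-cong n (λ m → regroup j m) ⟩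
  sumTo n (λ m → c j *ᶻ d m *ᶻ shift (j * suc k + m * suc l) a n) ∎
  where
  regroup : ∀ j m → c j *ᶻ (d m *ᶻ shift (m * suc l) (shift (j * suc k) a) n)
                  ≡ c j *ᶻ d m *ᶻ shift (j * suc k + m * suc l) a n
  regroup j m = trans (cong (λ t → c j *ᶻ (d m *ᶻ t)) (shift-shift (m * suc l) (j * suc k) a n))
                      (sym (ℤₚ.*-assoc (c j) (d m) _))

mul-comm : ∀ c k d l (a : Series) → mul c k (mul d l a) ≗ mul d l (mul c k a)
mul-comm c k d l a n = begin
  mul c k (mul d l a) n
    ≡⟨ mul-mul c k d l a n ⟩
  sumTo n (λ j → sumTo n (λ m → c j *ᶻ d m *ᶻ shift (j * suc k + m * suc l) a n))
    ≡⟨ sumTo-swap n n _ ⟩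
  sumTo n (λ m → sumTo n (λ j → c j *ᶻ d m *ᶻ shift (j * suc k + m * suc l) a n))
    ≡⟨ sumTo-cong n (λ m → sumTo-cong n (λ j → swap j m)) ⟩
  sumTo n (λ m → sumTo n (λ j → d m *ᶻ c j *ᶻ shift (m * suc l + j * suc k) a n))
    ≡⟨ mul-mul d l c k a n ⟨
  mul d l (mul c k a) n ∎
  where
  swap : ∀ j m → c j *ᶻ d m *ᶻ shift (j * suc k + m * suc l) a n
               ≡ d m *ᶻ c j *ᶻ shift (m * suc l + j * suc k) a n
  swap j m = cong₂ _*ᶻ_ (ℤₚ.*-comm (c j) (d m))
                        (cong (λ t → shift t a n) (+-comm (j * suc k) (m * suc l)))

mul-suc : ∀ c k (a : Series) n →
  mul c k a n ≡ c 0 *ᶻ a n +ᶻ shift (suc k) (mul (c ∘ suc) k a) n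
mul-suc c k a zero    = sym (ℤₚ.+-identityʳ _)
mul-suc c k a (suc n) = trans (sumTo-suc n _) (cong ((c 0 *ᶻ a (suc n)) +ᶻ_) higher)
  where
  vanish : ∀ j → n < j → c (suc j) *ᶻ shift (suc j * suc k) a (suc n) ≡ 0ℤ
  vanish j n<j = *-zeroʳ-≡ (c (suc j)) (shift-index> k a (s≤s n<j))
  higher : sumTo n (λ j → c (suc j) *ᶻ shift (suc j * suc k) a (suc n))
         ≡ shift (suc k) (mul (c ∘ suc) k a) (suc n)
  higher = begin
    sumTo n (λ j → c (suc j) *ᶻ shift (suc j * suc k) a (suc n))
      ≡⟨ sumTo-tail (n≤1+n n) vanish ⟨
    sumTo (suc n) (λ j → c (suc j) *ᶻ shift (suc j * suc k) a (suc n))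
      ≡⟨ sumTo-cong (suc n) (λ j →
           cong (c (suc j) *ᶻ_) (sym (shift-shift (j * suc k) (suc k) a (suc n)))) ⟩
    mul (c ∘ suc) k (shift (suc k) a) (suc n)
      ≡⟨ shift-mul (suc k) (c ∘ suc) k a (suc n) ⟨
    shift (suc k) (mul (c ∘ suc) k a) (suc n) ∎

mul-< : ∀ c k (a : Series) {n} → n < suc k → mul c k a n ≡ c 0 *ᶻ a n
mul-< c k a {n} n<1+k = begin
  mul c k a n                                           ≡⟨ mul-suc c k a n ⟩
  c 0 *ᶻ a n +ᶻ shift (suc k) (mul (c ∘ suc) k a) n ≡⟨ cong (c 0 *ᶻ a n +ᶻ_) higher ⟩
  c 0 *ᶻ a n +ᶻ 0ℤ                                    ≡⟨ ℤₚ.+-identityʳ _ ⟩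
  c 0 *ᶻ a n                                            ∎
  where
  higher : shift (suc k) (mul (c ∘ suc) k a) n ≡ 0ℤ
  higher = shift-> (mul (c ∘ suc) k a) n<1+k

mul-const : ∀ c k (a : Series) → (∀ j → c (suc j) ≡ 0ℤ) → ∀ n → mul c k a n ≡ c 0 *ᶻ a n
mul-const c k a c≡0 n = begin
  mul c k a n                                           ≡⟨ mul-suc c k a n ⟩
  c 0 *ᶻ a n +ᶻ shift (suc k) (mul (c ∘ suc) k a) n ≡⟨ cong (c 0 *ᶻ a n +ᶻ_) higher ⟩
  c 0 *ᶻ a n +ᶻ 0ℤ                                    ≡⟨ ℤₚ.+-identityʳ _ ⟩
  c 0 *ᶻ a n                                            ∎
  where
  higher : shift (suc k) (mul (c ∘ suc) k a) n ≡ 0ℤ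
  higher = trans (shift-cong (suc k) (mul-zeroˡ (c ∘ suc) k a c≡0) n)
                 (shift-map (suc k) (λ _ → 0ℤ) refl a n)

δ : Series
δ n = + (if n ≡ᵇ 0 then 1 else 0)

mul-δ : ∀ k (a : Series) → mul δ k a ≗ a
mul-δ k a n = trans (mul-const δ k a (λ _ → refl) n) (ℤₚ.*-identityˡ (a n))

ones : ℕ → ℤ
ones _ = 1ℤ

oneMinusX : ℕ → ℤ
oneMinusX zero          = 1ℤ
oneMinusX (suc zero)    = -1ℤ
oneMinusX (suc (suc _)) = 0ℤ

-- U k and V k multiply by 1/(1 - x^(1+k)) and by 1 - x^(1+k).
U V : ℕ → Series → Series
U = mul ones
V = mul oneMinusX

U-shift : ∀ k (a : Series) n → U k a n ≡ a n +ᶻ shift (suc k) (U k a) n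
U-shift k a n =
  trans (mul-suc ones k a n) (cong (_+ᶻ shift (suc k) (U k a) n) (ℤₚ.*-identityˡ (a n)))

V-shift : ∀ k (a : Series) n → V k a n ≡ a n -ᶻ shift (suc k) a n
V-shift k a n = trans (mul-suc oneMinusX k a n) (cong₂ _+ᶻ_ (ℤₚ.*-identityˡ (a n)) negated)
  where
  -a : mul (oneMinusX ∘ suc) k a ≗ negᶻ ∘ a
  -a m = trans (mul-const (oneMinusX ∘ suc) k a (λ _ → refl) m) (ℤₚ.-1*i≡-i (a m))
  negated : shift (suc k) (mul (oneMinusX ∘ suc) k a) n ≡ negᶻ (shift (suc k) a n)
  negated = trans (shift-cong (suc k) -a n) (shift-map (suc k) negᶻ refl a n)

V-U : ∀ k (a : Series) → V k (U k a) ≗ a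
V-U k a n = begin
  V k (U k a) n            ≡⟨ V-shift k (U k a) n ⟩
  U k a n -ᶻ s             ≡⟨ cong (_-ᶻ s) (U-shift k a n) ⟩
  (a n +ᶻ s) -ᶻ s          ≡⟨ //-rightDividesʳ s (a n) ⟩
  a n                      ∎
  where
  s = shift (suc k) (U k a) n

U-V : ∀ k (a : Series) → U k (V k a) ≗ a
U-V k a n = trans (mul-comm ones k oneMinusX k a n) (V-U k a n)

below : ℕ → ℕ → ℤ
below R j = if j <ᵇ R then 1ℤ else 0ℤ

-- (1 - x^K)(1 + x^K + ⋯ + x^((R-1)K)) = 1 - x^(RK), with K = 1 + k.
mul-below-telescopes : ∀ R k (a : Series) n →
  mul (below R) k a n -ᶻ shift (suc k) (mul (below R) k a) n ≡ a n -ᶻ shift (R * suc k) a n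
mul-below-telescopes zero k a n =
  trans (cong₂ _-ᶻ_ (mul-zeroˡ (below 0) k a (λ _ → refl) n)
                    (trans (shift-cong (suc k) (mul-zeroˡ (below 0) k a (λ _ → refl)) n)
                           (shift-map (suc k) (λ _ → 0ℤ) refl a n)))
        (sym (ℤₚ.+-inverseʳ (a n)))
mul-below-telescopes (suc R) k a n = begin
  D′ n -ᶻ shift K D′ n
    ≡⟨ cong₂ _-ᶻ_ (D′-rec n) (trans (shift-cong K D′-rec n) (shift-zipWith K _+ᶻ_ refl a KD n)) ⟩
  (a n +ᶻ shift K D n) -ᶻ (shift K a n +ᶻ shift K KD n)
    ≡⟨ regroup (a n) (shift K D n) (shift K a n) (shift K KD n) ⟩
  (a n -ᶻ shift K a n) +ᶻ (shift K D n -ᶻ shift K KD n)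
    ≡⟨ cong (a n -ᶻ shift K a n +ᶻ_) (shift-zipWith K _-ᶻ_ refl D KD n) ⟨
  (a n -ᶻ shift K a n) +ᶻ shift K (λ m → D m -ᶻ KD m) n
    ≡⟨ cong (a n -ᶻ shift K a n +ᶻ_) (shift-cong K (mul-below-telescopes R k a) n) ⟩
  (a n -ᶻ shift K a n) +ᶻ shift K (λ m → a m -ᶻ shift (R * K) a m) n
    ≡⟨ cong (a n -ᶻ shift K a n +ᶻ_) (shift-zipWith K _-ᶻ_ refl a (shift (R * K) a) n) ⟩
  (a n -ᶻ shift K a n) +ᶻ (shift K a n -ᶻ shift K (shift (R * K) a) n)
    ≡⟨ ℤₚ.+-minus-telescope (a n) (shift K a n) _ ⟩
  a n -ᶻ shift K (shift (R * K) a) n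
    ≡⟨ cong (a n -ᶻ_) (shift-shift K (R * K) a n) ⟩
  a n -ᶻ shift (R * K + K) a n
    ≡⟨ cong (λ t → a n -ᶻ shift t a n) (+-comm (R * K) K) ⟩
  a n -ᶻ shift (suc R * K) a n ∎
  where
  K = suc k
  D D′ KD : Series
  D  = mul (below R) k a
  D′ = mul (below (suc R)) k a
  KD = shift K D
  D′-rec : ∀ m → D′ m ≡ a m +ᶻ shift K D m
  D′-rec m = trans (mul-suc (below (suc R)) k a m) (cong (_+ᶻ KD m) (ℤₚ.*-identityˡ (a m)))
  regroup : ∀ x y z w → (x +ᶻ y) -ᶻ (z +ᶻ w) ≡ (x -ᶻ z) +ᶻ (y -ᶻ w)
  regroup = solve-∀

mul-below : ∀ R k (a : Series) → mul (below (suc R)) k a ≗ U k (V (k + R * suc k) a)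
mul-below R k a n = begin
  mul (below (suc R)) k a n             ≡⟨ U-V k (mul (below (suc R)) k a) n ⟨
  U k (V k (mul (below (suc R)) k a)) n ≡⟨ mul-cong ones k telescoped n ⟩
  U k (V (k + R * suc k) a) n           ∎
  where
  telescoped : V k (mul (below (suc R)) k a) ≗ V (k + R * suc k) a
  telescoped m = begin
    V k (mul (below (suc R)) k a) m
      ≡⟨ V-shift k (mul (below (suc R)) k a) m ⟩
    mul (below (suc R)) k a m -ᶻ shift (suc k) (mul (below (suc R)) k a) m
      ≡⟨ mul-below-telescopes (suc R) k a m ⟩
    a m -ᶻ shift (suc R * suc k) a m
      ≡⟨ V-shift (k + R * suc k) a m ⟨
    V (k + R * suc k) a m ∎

when : Bool → (Series → Series) → Series → Series
when true  f a = f a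
when false f a = a

when-mul-cong : ∀ b c k {a a′ : Series} → a ≗ a′ → when b (mul c k) a ≗ when b (mul c k) a′
when-mul-cong true  c k a≗a′ = mul-cong c k a≗a′
when-mul-cong false c k a≗a′ = a≗a′

when-mul-comm : ∀ b c k b′ d l (a : Series) →
  when b (mul c k) (when b′ (mul d l) a) ≗ when b′ (mul d l) (when b (mul c k) a)
when-mul-comm true  c k true  d l a = mul-comm c k d l a
when-mul-comm true  c k false d l a = λ _ → refl
when-mul-comm false c k true  d l a = λ _ → refl
when-mul-comm false c k false d l a = λ _ → refl

when-mul-< : ∀ b {c} k (a : Series) {n} → c 0 ≡ 1ℤ → n < suc k → when b (mul c k) a n ≡ a n
when-mul-< true  {c} k a {n} c0≡1 n<1+k =
  trans (mul-< c k a n<1+k) (trans (cong (_*ᶻ a n) c0≡1) (ℤₚ.*-identityˡ (a n)))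
when-mul-< false k a c0≡1 n<1+k = refl

prodWhen : (ℕ → Bool) → (ℕ → ℕ → ℤ) → (ℕ → ℕ) → ℕ → Series → Series
prodWhen b c k zero    a = a
prodWhen b c k (suc i) a = when (b i) (mul (c i) (k i)) (prodWhen b c k i a)

prodWhen-comm : ∀ b c k i b′ d l (a : Series) →
  prodWhen b c k i (when b′ (mul d l) a) ≗ when b′ (mul d l) (prodWhen b c k i a)
prodWhen-comm b c k zero    b′ d l a = λ _ → refl
prodWhen-comm b c k (suc i) b′ d l a n =
  trans (when-mul-cong (b i) (c i) (k i) (prodWhen-comm b c k i b′ d l a) n)
        (when-mul-comm (b i) (c i) (k i) b′ d l (prodWhen b c k i a) n)

⟦_⟧ : Bool → ℤ
⟦ true  ⟧ = 1ℤ
⟦ false ⟧ = 0ℤ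

U-top : ∀ b m (z : Series) → z 0 ≡ 1ℤ → when b (U m) z (suc m) ≡ z (suc m) +ᶻ ⟦ b ⟧
U-top true  m z z0≡1 = trans (U-shift m z (suc m)) (cong (z (suc m) +ᶻ_) (begin
  shift (suc m) (U m z) (suc m) ≡⟨ shift-≤ (U m z) (≤-refl {suc m}) ⟩
  U m z (m ∸ m)                 ≡⟨ cong (U m z) (n∸n≡0 m) ⟩
  1ℤ *ᶻ z 0                     ≡⟨ ℤₚ.*-identityˡ (z 0) ⟩
  z 0                           ≡⟨ z0≡1 ⟩
  1ℤ                            ∎))
U-top false m z z0≡1 = sym (ℤₚ.+-identityʳ _)

V-top : ∀ b m (z : Series) → z 0 ≡ 1ℤ → when b (V m) z (suc m) ≡ z (suc m) -ᶻ ⟦ b ⟧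
V-top true  m z z0≡1 = trans (V-shift m z (suc m)) (cong (z (suc m) -ᶻ_) (begin
  shift (suc m) z (suc m) ≡⟨ shift-≤ z (≤-refl {suc m}) ⟩
  z (m ∸ m)               ≡⟨ cong z (n∸n≡0 m) ⟩
  z 0                     ≡⟨ z0≡1 ⟩
  1ℤ                      ∎))
V-top false m z z0≡1 = sym (ℤₚ.+-identityʳ _)

-- Comparing coefficients of x^(1+m) decides which of the factors U m, V m occur on
-- either side, since ⟦ a ⟧ - ⟦ b ⟧ = ⟦ c ⟧ has only three solutions.
UV-step : ∀ m a b c {x y : Series} → x ≗ y → x 0 ≡ 1ℤ →
  when a (U m) (when b (V m) x) (suc m) ≡ when c (U m) y (suc m) →
  (c ≡ true → a ≡ true) × (when a (U m) (when b (V m) x) ≗ when c (U m) y)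
UV-step m a b c {x} {y} x≗y x0≡1 tops = solutions a b c balance
  where
  Vx0≡1 : when b (V m) x 0 ≡ 1ℤ
  Vx0≡1 = trans (when-mul-< b {oneMinusX} m x refl (s≤s z≤n)) x0≡1
  reassoc : ∀ x a b → x +ᶻ (a -ᶻ b) ≡ (x -ᶻ b) +ᶻ a
  reassoc = solve-∀
  balance : ⟦ a ⟧ -ᶻ ⟦ b ⟧ ≡ ⟦ c ⟧
  balance = ∙-cancelˡ (x (suc m)) _ _ (begin
    x (suc m) +ᶻ (⟦ a ⟧ -ᶻ ⟦ b ⟧)         ≡⟨ reassoc (x (suc m)) ⟦ a ⟧ ⟦ b ⟧ ⟩
    (x (suc m) -ᶻ ⟦ b ⟧) +ᶻ ⟦ a ⟧         ≡⟨ cong (_+ᶻ ⟦ a ⟧) (V-top b m x x0≡1) ⟨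
    when b (V m) x (suc m) +ᶻ ⟦ a ⟧       ≡⟨ U-top a m (when b (V m) x) Vx0≡1 ⟨
    when a (U m) (when b (V m) x) (suc m) ≡⟨ tops ⟩
    when c (U m) y (suc m)                ≡⟨ U-top c m y (trans (sym (x≗y 0)) x0≡1) ⟩
    y (suc m) +ᶻ ⟦ c ⟧                    ≡⟨ cong (_+ᶻ ⟦ c ⟧) (x≗y (suc m)) ⟨
    x (suc m) +ᶻ ⟦ c ⟧                    ∎)
  solutions : ∀ a b c → ⟦ a ⟧ -ᶻ ⟦ b ⟧ ≡ ⟦ c ⟧ →
    (c ≡ true → a ≡ true) × (when a (U m) (when b (V m) x) ≗ when c (U m) y)
  solutions true  true  false _ = (λ ()) , λ n → trans (U-V m x n) (x≗y n)
  solutions true  false true  _ = (λ _ → refl) , mul-cong ones m x≗y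
  solutions false false false _ = (λ ()) , x≗y
  solutions true  true  true  ()
  solutions true  false false ()
  solutions false true  true  ()
  solutions false true  false ()
  solutions false false true  ()

countSeries : (ℕ → ℕ → ℕ) → ℕ → Series
countSeries w k n = + count w k n

+-sumUpTo : ∀ N (f : ℕ → ℕ) → + sumUpTo N f ≡ sumTo N (λ j → + f j)
+-sumUpTo zero    f = refl
+-sumUpTo (suc N) f =
  trans (ℤₚ.pos-+ (sumUpTo N f) (f (suc N))) (cong (_+ᶻ + f (suc N)) (+-sumUpTo N f))

countSeries-suc : ∀ w k →
  countSeries w (suc k) ≗ mul (λ j → + w (suc k) j) k (countSeries w k)
countSeries-suc w k n = trans (+-sumUpTo n _) (sumTo-cong n term)
  where
  term : ∀ j → + (if j * suc k ≤ᵇ n then w (suc k) j * count w k (n ∸ j * suc k) else 0)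
             ≡ + w (suc k) j *ᶻ shift (j * suc k) (countSeries w k) n
  term j with j * suc k ≤ᵇ n
  ... | true  = ℤₚ.pos-* (w (suc k) j) (count w k (n ∸ j * suc k))
  ... | false = sym (ℤₚ.*-zeroʳ (+ w (suc k) j))

countSeries-stable : ∀ w → (∀ i → w i 0 ≡ 1) → ∀ {n K} → n ≤ K →
  countSeries w K n ≡ countSeries w n n
countSeries-stable w w0≡1 {n} n≤K = go (≤⇒≤′ n≤K)
  where
  go : ∀ {K} → n ≤′ K → countSeries w K n ≡ countSeries w n n
  go ≤′-refl = refl
  go {suc K} (≤′-step n≤′K) = begin
    countSeries w (suc K) n
      ≡⟨ countSeries-suc w K n ⟩
    mul (λ j → + w (suc K) j) K (countSeries w K) n
      ≡⟨ mul-< (λ j → + w (suc K) j) K (countSeries w K) (s≤s (≤′⇒≤ n≤′K)) ⟩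
    + w (suc K) 0 *ᶻ countSeries w K n
      ≡⟨ cong (λ t → + t *ᶻ countSeries w K n) (w0≡1 (suc K)) ⟩
    1ℤ *ᶻ countSeries w K n
      ≡⟨ ℤₚ.*-identityˡ _ ⟩
    countSeries w K n
      ≡⟨ go n≤′K ⟩
    countSeries w n n ∎

module _ (r′ : ℕ) (S₁ S₂ : Subset) (euler : EulerPair (2 + r′) S₁ S₂) where

  private
    r : ℕ
    r = 2 + r′

  -- The index of the part r·(1+t): suc (scaledIndex t) reduces to r * suc t.
  scaledIndex : ℕ → ℕ
  scaledIndex t = t + suc r′ * suc t

  qSeries pSeries : ℕ → Series
  qSeries = countSeries (qW r S₁)
  pSeries = countSeries (pW S₂)

  qFactor : ∀ b k (a : Series) →
    mul (λ j → + (if b ∧ (j <ᵇ r) then 1 else (if j ≡ᵇ 0 then 1 else 0))) k a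
      ≗ when b (U k) (when b (V (scaledIndex k)) a)
  qFactor false k a = mul-δ k a
  qFactor true  k a n = trans (mul-congˡ k a coefficients n) (mul-below (suc r′) k a n)
    where
    coefficients : ∀ j → + (if j <ᵇ r then 1 else (if j ≡ᵇ 0 then 1 else 0)) ≡ below r j
    coefficients zero = refl
    coefficients (suc j) with suc j <ᵇ r
    ... | true  = refl
    ... | false = refl

  pFactor : ∀ b k (a : Series) →
    mul (λ j → + (if b then 1 else (if j ≡ᵇ 0 then 1 else 0))) k a ≗ when b (U k) a
  pFactor true  k a = λ _ → refl
  pFactor false k a = mul-δ k a

  -- Uprod k = ∏_{i ≤ k, i ∈ S₁} 1/(1 - x^i) and Vprod t a = a · ∏_{i ≤ t, i ∈ S₁} (1 - x^(ri)).
  Uprod : ℕ → Series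
  Uprod k = prodWhen (S₁ ∘ suc) (λ _ → ones) id k δ

  Vprod : ℕ → Series → Series
  Vprod = prodWhen (S₁ ∘ suc) (λ _ → oneMinusX) scaledIndex

  Vprod-comm-U : ∀ t b m (a : Series) → Vprod t (when b (U m) a) ≗ when b (U m) (Vprod t a)
  Vprod-comm-U t b m = prodWhen-comm (S₁ ∘ suc) (λ _ → oneMinusX) scaledIndex t b ones m

  qSeries-factorised : ∀ k → qSeries k ≗ Vprod k (Uprod k)
  qSeries-factorised zero    = λ _ → refl
  qSeries-factorised (suc k) n = begin
    qSeries (suc k) n
      ≡⟨ countSeries-suc (qW r S₁) k n ⟩
    mul (λ j → + qW r S₁ (suc k) j) k (qSeries k) n
      ≡⟨ qFactor A k (qSeries k) n ⟩
    when A (U k) (when A (V (scaledIndex k)) (qSeries k)) n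
      ≡⟨ when-mul-cong A ones k
           (when-mul-cong A oneMinusX (scaledIndex k) (qSeries-factorised k)) n ⟩
    when A (U k) (Vprod (suc k) (Uprod k)) n
      ≡⟨ Vprod-comm-U (suc k) A k (Uprod k) n ⟨
    Vprod (suc k) (Uprod (suc k)) n ∎
    where
    A = S₁ (suc k)

  Vprod-truncate : ∀ {t m} (a : Series) {n} → t ≤′ m → n < r * suc t →
    Vprod m a n ≡ Vprod t a n
  Vprod-truncate a ≤′-refl n<r[1+t] = refl
  Vprod-truncate {t} {suc m} a (≤′-step t≤′m) n<r[1+t] =
    trans (when-mul-< (S₁ (suc m)) {oneMinusX} (scaledIndex m) (Vprod m a) refl
            (<-≤-trans n<r[1+t] (*-monoʳ-≤ r (s≤s (≤′⇒≤ t≤′m)))))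
          (Vprod-truncate a t≤′m n<r[1+t])

  -- β m holds iff 1 + m = r·i for some i ∈ S₁; ordered m is the product of those
  -- factors 1/(1 - x^i) and 1 - x^(ri) of the left side of the Euler-pair identity
  -- whose exponent is at most m.
  β : ℕ → Bool
  β m = (suc m % r ≡ᵇ 0) ∧ S₁ (suc m / r)

  ordered : ℕ → Series
  ordered zero    = δ
  ordered (suc m) = when (S₁ (suc m)) (U m) (when (β m) (V m) (ordered m))

  scaledIndex-as-quotient : ∀ t → t * r + suc r′ ≡ scaledIndex t
  scaledIndex-as-quotient t = identity t r′
    where
    identity : ∀ t r′ → t * (2 + r′) + suc r′ ≡ t + suc r′ * suc t
    identity = ℕ-Solver.solve-∀

  suc-scaledIndex : ∀ t → suc (scaledIndex t) ≡ suc t * r + 0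
  suc-scaledIndex t = identity t r′
    where
    identity : ∀ t r′ → suc (t + suc r′ * suc t) ≡ suc t * (2 + r′) + 0
    identity = ℕ-Solver.solve-∀

  β-skip : ∀ t s → suc s < r → β (t * r + s) ≡ false
  β-skip t s 1+s<r = cong (λ x → (x ≡ᵇ 0) ∧ S₁ (suc (t * r + s) / r)) (begin
    suc (t * r + s) % r ≡⟨ cong (λ x → suc x % r) (+-comm (t * r) s) ⟩
    (suc s + t * r) % r ≡⟨ [m+kn]%n≡m%n (suc s) t r ⟩
    suc s % r           ≡⟨ m<n⇒m%n≡m 1+s<r ⟩
    suc s               ∎)

  β-multiple : ∀ t → β (scaledIndex t) ≡ S₁ (suc t)
  β-multiple t = cong₂ (λ x y → (x ≡ᵇ 0) ∧ S₁ y)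
    (trans (cong (_% r) (*-comm r (suc t))) (m*n%n≡0 (suc t) r))
    (trans (cong (_/ r) (*-comm r (suc t))) (m*n/n≡m (suc t) r))

  ordered-step : ∀ {m t t′} → (∀ a → when (β m) (V m) (Vprod t a) ≗ Vprod t′ a) →
    ordered m ≗ Vprod t (Uprod m) → ordered (suc m) ≗ Vprod t′ (Uprod (suc m))
  ordered-step {m} {t} {t′} V-step ordered≗ n = begin
    when A (U m) (when (β m) (V m) (ordered m)) n
      ≡⟨ when-mul-cong A ones m (when-mul-cong (β m) oneMinusX m ordered≗) n ⟩
    when A (U m) (when (β m) (V m) (Vprod t (Uprod m))) n
      ≡⟨ when-mul-cong A ones m (V-step (Uprod m)) n ⟩
    when A (U m) (Vprod t′ (Uprod m)) n
      ≡⟨ Vprod-comm-U t′ A m (Uprod m) n ⟨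
    Vprod t′ (Uprod (suc m)) n ∎
    where
    A = S₁ (suc m)

  ordered-reindex : ∀ {t m m′} → m ≡ m′ →
    ordered m ≗ Vprod t (Uprod m) → ordered m′ ≗ Vprod t (Uprod m′)
  ordered-reindex refl ordered≗ = ordered≗

  ordered-factorised : ∀ t s → s < r → ordered (t * r + s) ≗ Vprod t (Uprod (t * r + s))
  ordered-factorised zero    zero    _     = λ _ → refl
  ordered-factorised t       (suc s) 1+s<r =
    ordered-reindex {t} (sym (+-suc (t * r) s)) (ordered-step {t = t} {t} skip
      (ordered-factorised t s (<-trans (n<1+n s) 1+s<r)))
    where
    skip : ∀ a → when (β (t * r + s)) (V (t * r + s)) (Vprod t a) ≗ Vprod t a
    skip a n = cong (λ b → when b (V (t * r + s)) (Vprod t a) n) (β-skip t s 1+s<r)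
  ordered-factorised (suc t) zero    _     =
    ordered-reindex {suc t} (suc-scaledIndex t) (ordered-step {t = t} {suc t} multiple
      (ordered-reindex {t} (scaledIndex-as-quotient t) (ordered-factorised t (suc r′) ≤-refl)))
    where
    multiple : ∀ a → when (β (scaledIndex t)) (V (scaledIndex t)) (Vprod t a) ≗ Vprod (suc t) a
    multiple a n = cong (λ b → when b (V (scaledIndex t)) (Vprod t a) n) (β-multiple t)

  qSeries≡ordered : ∀ {m n} → n ≤ m → qSeries m n ≡ ordered m n
  qSeries≡ordered {m} {n} n≤m = begin
    qSeries m n
      ≡⟨ qSeries-factorised m n ⟩
    Vprod m (Uprod m) n
      ≡⟨ Vprod-truncate (Uprod m) (≤⇒≤′ (m/n≤m m r)) (≤-<-trans n≤m m<r[1+m/r]) ⟩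
    Vprod (m / r) (Uprod m) n
      ≡⟨ ordered-reindex {m / r} m/r*r+m%r≡m (ordered-factorised (m / r) (m % r) (m%n<n m r)) n ⟨
    ordered m n ∎
    where
    m/r*r+m%r≡m : m / r * r + m % r ≡ m
    m/r*r+m%r≡m = trans (+-comm (m / r * r) (m % r)) (sym (m≡m%n+[m/n]*n m r))
    m<r[1+m/r] : m < r * suc (m / r)
    m<r[1+m/r] = subst (m <_) (*-comm (suc (m / r)) r)
      (subst (_< r + m / r * r) (sym (m≡m%n+[m/n]*n m r)) (+-monoˡ-< (m / r * r) (m%n<n m r)))

  qSeries≡pSeries : ∀ {m n} → n ≤ m → qSeries m n ≡ pSeries m n
  qSeries≡pSeries {m} {n} n≤m = begin
    qSeries m n ≡⟨ countSeries-stable (qW r S₁) qW0≡1 n≤m ⟩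
    + q r S₁ n  ≡⟨ cong +_ (euler n) ⟩
    + p S₂ n    ≡⟨ countSeries-stable (pW S₂) pW0≡1 n≤m ⟨
    pSeries m n ∎
    where
    qW0≡1 : ∀ i → qW r S₁ i 0 ≡ 1
    qW0≡1 i with S₁ i
    ... | true  = refl
    ... | false = refl
    pW0≡1 : ∀ i → pW S₂ i 0 ≡ 1
    pW0≡1 i with S₂ i
    ... | true  = refl
    ... | false = refl

  ordered-at-0 : ∀ m → ordered m 0 ≡ 1ℤ
  ordered-at-0 zero    = refl
  ordered-at-0 (suc m) =
    trans (when-mul-< (S₁ (suc m)) {ones} m _ refl (s≤s z≤n))
          (trans (when-mul-< (β m) {oneMinusX} m (ordered m) refl (s≤s z≤n)) (ordered-at-0 m))

  pSeries-suc : ∀ m → pSeries (suc m) ≗ when (S₂ (suc m)) (U m) (pSeries m)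
  pSeries-suc m n =
    trans (countSeries-suc (pW S₂) m n) (pFactor (S₂ (suc m)) m (pSeries m) n)

  ordered≗pSeries : ∀ m → ordered m ≗ pSeries m
  euler-step : ∀ m → (S₂ (suc m) ≡ true → S₁ (suc m) ≡ true) ×
                     (ordered (suc m) ≗ when (S₂ (suc m)) (U m) (pSeries m))

  ordered≗pSeries zero      = λ _ → refl
  ordered≗pSeries (suc m) n = trans (proj₂ (euler-step m) n) (sym (pSeries-suc m n))

  euler-step m =
    UV-step m (S₁ (suc m)) (β m) (S₂ (suc m)) (ordered≗pSeries m) (ordered-at-0 m) (begin
      ordered (suc m) (suc m)                     ≡⟨ qSeries≡ordered (≤-refl {suc m}) ⟨
      qSeries (suc m) (suc m)                     ≡⟨ qSeries≡pSeries (≤-refl {suc m}) ⟩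
      pSeries (suc m) (suc m)                     ≡⟨ pSeries-suc m (suc m) ⟩
      when (S₂ (suc m)) (U m) (pSeries m) (suc m) ∎)

  EulerPair⇒⊆ : ∀ m → S₂ (suc m) ≡ true → S₁ (suc m) ≡ true
  EulerPair⇒⊆ m = proj₁ (euler-step m)

%-cong-+ : ∀ d .{{_ : NonZero d}} {a a′ b b′} → a % d ≡ a′ % d → b % d ≡ b′ % d →
  (a + b) % d ≡ (a′ + b′) % d
%-cong-+ d {a} {a′} {b} {b′} a≡a′ b≡b′ = begin
  (a + b) % d                 ≡⟨ %-distribˡ-+ a b d ⟩
  (a % d + b % d) % d         ≡⟨ cong₂ (λ x y → (x + y) % d) a≡a′ b≡b′ ⟩
  (a′ % d + b′ % d) % d       ≡⟨ %-distribˡ-+ a′ b′ d ⟨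
  (a′ + b′) % d               ∎

%-cong-* : ∀ d .{{_ : NonZero d}} {a a′ b b′} → a % d ≡ a′ % d → b % d ≡ b′ % d →
  (a * b) % d ≡ (a′ * b′) % d
%-cong-* d {a} {a′} {b} {b′} a≡a′ b≡b′ = begin
  (a * b) % d                 ≡⟨ %-distribˡ-* a b d ⟩
  (a % d * (b % d)) % d       ≡⟨ cong₂ (λ x y → (x * y) % d) a≡a′ b≡b′ ⟩
  (a′ % d * (b′ % d)) % d     ≡⟨ %-distribˡ-* a′ b′ d ⟨
  (a′ * b′) % d               ∎

sumUpTo-cong-% : ∀ d .{{_ : NonZero d}} N {f g : ℕ → ℕ} → (∀ j → f j % d ≡ g j % d) →
  sumUpTo N f % d ≡ sumUpTo N g % d
sumUpTo-cong-% d zero    f≡g = f≡g 0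
sumUpTo-cong-% d (suc N) f≡g = %-cong-+ d (sumUpTo-cong-% d N f≡g) (f≡g (suc N))

count-cong-% : ∀ d .{{_ : NonZero d}} {w w′ : ℕ → ℕ → ℕ} →
  (∀ i j → w (suc i) j % d ≡ w′ (suc i) j % d) → ∀ k n → count w k n % d ≡ count w′ k n % d
count-cong-% d w≡w′ zero    n = refl
count-cong-% d {w} {w′} w≡w′ (suc k) n = sumUpTo-cong-% d n term
  where
  term : ∀ j → (if j * suc k ≤ᵇ n then w (suc k) j * count w k (n ∸ j * suc k) else 0) % d
             ≡ (if j * suc k ≤ᵇ n then w′ (suc k) j * count w′ k (n ∸ j * suc k) else 0) % d
  term j with j * suc k ≤ᵇ n
  ... | true  = %-cong-* d (w≡w′ k j) (count-cong-% d w≡w′ k (n ∸ j * suc k))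
  ... | false = refl

pbarW≡pW-mod₂ : ∀ S₁ S₂ i j → (S₂ i ≡ true → S₁ i ≡ true) →
  pbarW S₁ S₂ i j % 2 ≡ pW S₂ i j % 2
pbarW≡pW-mod₂ S₁ S₂ i j S₂i⇒S₁i with S₁ i | S₂ i | S₂i⇒S₁i | j
... | true  | true  | _       | zero  = refl
... | true  | true  | _       | suc _ = refl
... | true  | false | _       | zero  = refl
... | true  | false | _       | suc _ = refl
... | false | true  | S₂i⇒S₁i | _     = contradiction (S₂i⇒S₁i refl) λ ()
... | false | false | _       | _     = refl

theorem3p7 : (r : ℕ) → 2 ≤ r → (S₁ S₂ : Subset) → EulerPair r S₁ S₂ →
    (n : ℕ) → q r S₁ n % 2 ≡ pbar r S₁ S₂ n % 2
theorem3p7 r@(suc (suc r′)) (s≤s (s≤s z≤n)) S₁ S₂ euler n = begin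
  q r S₁ n % 2       ≡⟨ cong (_% 2) (euler n) ⟩
  p S₂ n % 2         ≡⟨ count-cong-% 2 pbarW≡pW n n ⟨
  pbar r S₁ S₂ n % 2 ∎
  where
  pbarW≡pW : ∀ i j → pbarW S₁ S₂ (suc i) j % 2 ≡ pW S₂ (suc i) j % 2
  pbarW≡pW i j = pbarW≡pW-mod₂ S₁ S₂ (suc i) j (EulerPair⇒⊆ r′ S₁ S₂ euler i)
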